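{- Let $N$ be a positive integer, $\boldsymbol{k}=(k_1,\dots,k_r)$ an index, and $\boldsymbol{x}=(x_1,\dots,x_r)$ indeterminates. When $k_1>1$, \[ \frac{\Delta^{(N)}\widetilde{\mathrm{Li}}_{\boldsymbol{k}}^{\sqcup\!\sqcup, (N)}(\boldsymbol{x})}{\Delta^{(N)}x_1}=-\frac{1}{x_1}\widetilde{\mathrm{Li}}_{\boldsymbol{k}^{\downarrow}_1}^{\sqcup\!\sqcup, (N)}(\boldsymbol{x}); \] when $r=1$ and $k_1=1$, \[ \frac{\Delta^{(N)}\widetilde{\mathrm{Li}}_{\boldsymbol{k}}^{\sqcup\!\sqcup, (N)}(\boldsymbol{x})}{\Delta^{(N)}x_1}=\frac{1}{x_1}-\frac{1}{x_1+N^{ -1}-1}; \] when $r>1$ and $k_1=1$, \[ \frac{\Delta^{(N)}\widetilde{\mathrm{Li}}_{\boldsymbol{k}}^{\sqcup\!\sqcup, (N)}(\boldsymbol{x})}{\Delta^{(N)}x_1} = \frac{1}{x_1}\widetilde{\mathrm{Li}}_{\boldsymbol{k}^{\wedge}_1}^{\sqcup\!\sqcup, (N)}(\boldsymbol{x}^{\wedge}_1)-\frac{1}{x_1+N^{ -1}-x_2}\left(\widetilde{\mathrm{Li}}_{\boldsymbol{k}^{\wedge}_1}^{\sqcup\!\sqcup, (N)}(\boldsymbol{x}^{\wedge}_1)-\widetilde{\mathrm{Li}}_{\boldsymbol{k}^{\wedge}_1}^{\sqcup\!\sqcup, (N)}(\boldsymbol{x}^{\wedge}_2)\bigg|_{x_1+N^{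 -1}}\right). \]
   Context: Here $\sqcup\!\sqcup$ denotes the shuffle symbol. With $x_{r+1}\coloneqq1$, \[ \widetilde{\mathrm{Li}}_{\boldsymbol{k}}^{\sqcup\!\sqcup,(N)}(\boldsymbol{x})\coloneqq\sum_{0<n_1<\cdots<n_r<N}\frac{1}{n_1^{k_1}\cdots n_r^{k_r}}\prod_{i=1}^{r}\frac{\binom{Nx_{i+1}-1}{n_i}}{\binom{Nx_i-1}{n_i}}. \] The difference quotient is $\frac{\Delta^{(N)}f(\boldsymbol{x})}{\Delta^{(N)}x_i}\coloneqq N\bigl(f(x_1,\dots,x_i+N^{ -1},\dots,x_r)-f(\boldsymbol{x})\bigr)$, and $f(\boldsymbol{x})\big|_{x_i+N^{ -1}}\coloneqq f(x_1,\dots,x_{i-1},x_i+N^{ -1},x_{i+1},\dots,x_r)$. Notation: $\boldsymbol{k}^{\wedge}_i=(k_1,\dots,k_{i-1},k_{i+1},\dots,k_r)$, $\boldsymbol{k}^{\downarrow}_i=(k_1,\dots,k_{i-1},k_i-1,k_{i+1},\dots,k_r)$ (for $k_i>1$), $\boldsymbol{x}^{\wedge}_i=(x_1,\dots,x_{i-1},x_{i+1},\dots,x_r)$. -}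

module Defs where

open import Data.Nat as ℕ using (ℕ; zero; suc)
open import Data.Integer using (+_)
open import Data.Rational using (ℚ; 0ℚ; 1ℚ; _+_; _*_; _-_; -_; 1/_; _/_; ≢-nonZero)
open import Data.Rational.Properties using (_≟_)
open import Data.Vec using (Vec; []; _∷_)
open import Data.Vec.Relation.Unary.All using (All)
open import Relation.Nullary using (yes; no; ¬_)
open import Relation.Binary.PropositionalEquality using (_≡_; _≢_)

ℕ→ℚ : ℕ → ℚ
ℕ→ℚ n = (+ n) / 1

-- total inverse (inv 0 = 0); only used where the denominator is nonzero
inv : ℚ → ℚ
inv q with q ≟ 0ℚ
... | yes _ = 0ℚ
... | no q≢0 = 1/_ q {{≢-nonZero q≢0}}

infixl 7 _÷_
_÷_ : ℚ → ℚ → ℚ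
p ÷ q = p * inv q

_^_ : ℚ → ℕ → ℚ
q ^ zero = 1ℚ
q ^ suc n = q * (q ^ n)

fallingℚ : ℚ → ℕ → ℚ
fallingℚ a zero = 1ℚ
fallingℚ a (suc n) = fallingℚ a n * (a - ℕ→ℚ n)

binomℚ : ℚ → ℕ → ℚ
binomℚ a n = fallingℚ a n ÷ ℕ→ℚ (n ℕ.!)

-- Σ_{n=m+1}^{N-1} f n
sumRange : ℕ → ℕ → (ℕ → ℚ) → ℚ
sumRange m N f = go (N ℕ.∸ suc m)
  where
  go : ℕ → ℚ
  go zero = 0ℚ
  go (suc t) = go t + f (m ℕ.+ suc t)

binomRatio : ℕ → ℚ → ℚ → ℕ → ℚ
binomRatio N y x n =
  binomℚ (ℕ→ℚ N * y - 1ℚ) n ÷ binomℚ (ℕ→ℚ N * x - 1ℚ) n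

-- x_{i+1} for the remaining tail, with x_{r+1} = 1
nextX : ∀ {r} → Vec ℚ r → ℚ
nextX [] = 1ℚ
nextX (x ∷ _) = x

-- Sum over m < n_1 < ... < n_r < N of the summand
LiFrom : (N : ℕ) → ℕ → ∀ {r} → Vec ℕ r → Vec ℚ r → ℚ
LiFrom N m [] [] = 1ℚ
LiFrom N m (k ∷ ks) (x ∷ xs) =
  sumRange m N (λ n →
    (inv (ℕ→ℚ n ^ k) * binomRatio N (nextX xs) x n) * LiFrom N n ks xs)

Li : (N : ℕ) → ∀ {r} → Vec ℕ r → Vec ℚ r → ℚ
Li N k x = LiFrom N 0 k x

invN : ℕ → ℚ
invN N = inv (ℕ→ℚ N)

Δ₁ : (N : ℕ) → ∀ {r} → (Vec ℚ (suc r) → ℚ) → Vec ℚ (suc r) → ℚ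
Δ₁ N f (x ∷ xs) = ℕ→ℚ N * (f ((x + invN N) ∷ xs) - f (x ∷ xs))

-- genericity: N x_i ∉ {0, 1, ..., N} for every i (keeps all denominators nonzero)
Generic : ℕ → ∀ {r} → Vec ℚ r → Set
Generic N x = All (λ xi → (j : ℕ) → j ℕ.≤ N → ℕ→ℚ N * xi ≢ ℕ→ℚ j) x

IsIndex : ∀ {r} → Vec ℕ r → Set
IsIndex k = All (λ ki → 1 ℕ.≤ ki) k

{-# OPTIONS --safe #-}
-- Write a = N x₁ and c = N x₂ − 1 (c = N − 1 when r = 1).  After cancelling n!, the n-th
-- summand of Li carries the factor (c)ₙ / (a − 1)ₙ, and shifting x₁ by 1/N turns (a − 1)ₙ
-- into (a)ₙ, i.e. multiplies that factor by (a − n) / a.  So the difference quotient of the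
-- n-th summand is −(n / x₁) times the summand: one power of n cancels, which is the case
-- k₁ > 1.  For k₁ = 1 nothing is left to cancel, and Σₙ (c)ₙ / (a − 1)ₙ · Tₙ, with Tₙ the
-- tail sums, is summed by parts, since (c)ₙ / (a − 1)ₙ = C(n + 1) − C(n) for
-- C(n) = a / (a − c) · (1 − (c)ₙ / (a)ₙ).  Multiplying the next summand by (c)ₙ / (a)ₙ
-- replaces x₂ by x₁ + 1/N in it; for r = 1 the sum telescopes instead, and
-- C(N) = a / (a − c) because (N − 1)_N = 0.
module Submission where

open import Defs
open import Data.Nat as ℕ using (ℕ; zero; suc; _<_; _≤_; _∸_; z≤n; s≤s)
import Data.Nat.Properties as ℕ
import Data.Nat.Coprimality as Coprime
import Data.Integer as ℤ
import Data.Integer.Properties as ℤ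
open import Data.Rational using (ℚ; 0ℚ; 1ℚ; _+_; _*_; _-_; -_; _/_; mkℚ; ≢-nonZero)
import Data.Rational.Properties as ℚ
open import Data.Rational.Solver using (module +-*-Solver)
open import Algebra.Properties.Group ℚ.+-0-group using (x∙y⁻¹≈ε⇒x≈y)
open import Data.Vec using (Vec; []; _∷_; head)
open import Data.Vec.Relation.Unary.All using ([]; _∷_)
open import Data.Product using (_×_; _,_)
open import Data.Sum using (inj₁; inj₂)
open import Function using (_∘_)
open import Relation.Nullary using (Dec; yes; no; contradiction)
open import Relation.Binary.PropositionalEquality
open ≡-Reasoning
open +-*-Solver

*-inv : ∀ {p} → p ≢ 0ℚ → p * inv p ≡ 1ℚ
*-inv {p} p≢0 with p ℚ.≟ 0ℚ
... | yes p≡0 = contradiction p≡0 p≢0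
... | no p≢0′ = ℚ.*-inverseʳ p {{≢-nonZero p≢0′}}

inv-unique : ∀ p {q} → p * q ≡ 1ℚ → inv p ≡ q
inv-unique p {q} pq≡1 = begin
  inv p            ≡⟨ ℚ.*-identityʳ (inv p) ⟨
  inv p * 1ℚ       ≡⟨ cong (inv p *_) pq≡1 ⟨
  inv p * (p * q)  ≡⟨ solve 3 (λ p q i → i :* (p :* q) := (p :* i) :* q) refl p q (inv p) ⟩
  (p * inv p) * q  ≡⟨ cong (_* q) (*-inv p≢0) ⟩
  1ℚ * q           ≡⟨ ℚ.*-identityˡ q ⟩
  q                ∎
  where
  p≢0 : p ≢ 0ℚ
  p≢0 refl = ℚ.1≢0 (trans (sym pq≡1) (ℚ.*-zeroˡ q))

inv-* : ∀ p q → inv (p * q) ≡ inv p * inv q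
inv-* p q = cases (p ℚ.≟ 0ℚ) (q ℚ.≟ 0ℚ)
  where
  cases : Dec (p ≡ 0ℚ) → Dec (q ≡ 0ℚ) → inv (p * q) ≡ inv p * inv q
  cases (yes refl) _ = trans (cong inv (ℚ.*-zeroˡ q)) (sym (ℚ.*-zeroˡ (inv q)))
  cases (no _) (yes refl) = trans (cong inv (ℚ.*-zeroʳ p)) (sym (ℚ.*-zeroʳ (inv p)))
  cases (no p≢0) (no q≢0) = inv-unique (p * q) (begin
    (p * q) * (inv p * inv q)  ≡⟨ solve 4 (λ p q i j → (p :* q) :* (i :* j) := (p :* i) :* (q :* j))
                                          refl p q (inv p) (inv q) ⟩
    (p * inv p) * (q * inv q)  ≡⟨ cong₂ _*_ (*-inv p≢0) (*-inv q≢0) ⟩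
    1ℚ                         ∎)

inv-involutive : ∀ p → inv (inv p) ≡ p
inv-involutive p = cases (p ℚ.≟ 0ℚ)
  where
  cases : Dec (p ≡ 0ℚ) → inv (inv p) ≡ p
  cases (yes refl) = refl
  cases (no p≢0) = inv-unique (inv p) (trans (ℚ.*-comm (inv p) p) (*-inv p≢0))

*-≢0 : ∀ {p q} → p ≢ 0ℚ → q ≢ 0ℚ → p * q ≢ 0ℚ
*-≢0 {p} {q} p≢0 q≢0 pq≡0 = q≢0 (begin
  q                ≡⟨ ℚ.*-identityˡ q ⟨
  1ℚ * q           ≡⟨ cong (_* q) (*-inv p≢0) ⟨
  (p * inv p) * q  ≡⟨ solve 3 (λ p q i → (p :* i) :* q := i :* (p :* q)) refl p q (inv p) ⟩
  inv p * (p * q)  ≡⟨ cong (inv p *_) pq≡0 ⟩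
  inv p * 0ℚ       ≡⟨ ℚ.*-zeroʳ (inv p) ⟩
  0ℚ               ∎)

-≢0 : ∀ {p q} → p ≢ q → p - q ≢ 0ℚ
-≢0 p≢q = p≢q ∘ x∙y⁻¹≈ε⇒x≈y _ _

÷-*-÷ : ∀ p {q} r → q ≢ 0ℚ → (p ÷ q) * (q ÷ r) ≡ p ÷ r
÷-*-÷ p {q} r q≢0 = begin
  (p * inv q) * (q * inv r)  ≡⟨ solve 4 (λ p q i r → (p :* i) :* (q :* r) := (p :* r) :* (q :* i))
                                        refl p q (inv q) (inv r) ⟩
  (p * inv r) * (q * inv q)  ≡⟨ cong (p * inv r *_) (*-inv q≢0) ⟩
  (p * inv r) * 1ℚ           ≡⟨ ℚ.*-identityʳ _ ⟩
  p * inv r                  ∎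

ℕ→ℚ≡mkℚ : ∀ n → ℕ→ℚ n ≡ mkℚ (ℤ.+ n) 0 (Coprime.sym (Coprime.1-coprimeTo n))
ℕ→ℚ≡mkℚ n = ℚ.normalize-coprime _

ℕ→ℚ-suc : ∀ n → ℕ→ℚ (suc n) ≡ 1ℚ + ℕ→ℚ n
ℕ→ℚ-suc n = trans (cong (λ i → (ℤ.+ 1 ℤ.+ i) / 1) (sym (ℤ.*-identityʳ (ℤ.+ n))))
                  (cong (1ℚ +_) (sym (ℕ→ℚ≡mkℚ n)))

ℕ→ℚ-≢0 : ∀ n → .{{ℕ.NonZero n}} → ℕ→ℚ n ≢ 0ℚ
ℕ→ℚ-≢0 (suc n) eq with trans (sym (ℕ→ℚ≡mkℚ (suc n))) eq
... | ()

pred-≢ : ∀ {p} j → p ≢ ℕ→ℚ (suc j) → p - 1ℚ ≢ ℕ→ℚ j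
pred-≢ {p} j p≢1+j p-1≡j = p≢1+j (begin
  p                ≡⟨ solve 1 (λ p → p := con 1ℚ :+ (p :- con 1ℚ)) refl p ⟩
  1ℚ + (p - 1ℚ)    ≡⟨ cong (1ℚ +_) p-1≡j ⟩
  1ℚ + ℕ→ℚ j       ≡⟨ ℕ→ℚ-suc j ⟨
  ℕ→ℚ (suc j)      ∎)

downward-induction : ∀ N (P : ℕ → Set) → (∀ m → N ≤ suc m → P m) →
                     (∀ m → suc m < N → P (suc m) → P m) → ∀ m → P m
downward-induction N P base step m = go (N ∸ suc m) m refl
  where
  go : ∀ d m → N ∸ suc m ≡ d → P m
  go zero    m eq = base m (ℕ.m∸n≡0⇒m≤n eq)
  go (suc d) m eq = step m 1+m<N (go d (suc m) N∸2+m≡d)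
    where
    1+m<N : suc m < N
    1+m<N = ℕ.≰⇒> (λ N≤1+m → ℕ.0≢1+n (trans (sym (ℕ.m≤n⇒m∸n≡0 N≤1+m)) eq))
    N∸2+m≡d : N ∸ suc (suc m) ≡ d
    N∸2+m≡d = ℕ.suc-injective (trans (sym (ℕ.+-∸-assoc 1 1+m<N)) eq)

sumRange-empty : ∀ {m N} (f : ℕ → ℚ) → N ≤ suc m → sumRange m N f ≡ 0ℚ
sumRange-empty f N≤1+m rewrite ℕ.m≤n⇒m∸n≡0 N≤1+m = refl

sumRange-snoc : ∀ {m N} (f : ℕ → ℚ) → m < N → sumRange m (suc N) f ≡ sumRange m N f + f N
sumRange-snoc {m} {N} f m<N rewrite ℕ.+-∸-assoc 1 m<N =
  cong (λ n → sumRange m N f + f n) (trans (ℕ.+-suc m _) (ℕ.m+[n∸m]≡n m<N))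

sumRange-cons : ∀ {m N} (f : ℕ → ℚ) → suc m < N →
                sumRange m N f ≡ f (suc m) + sumRange (suc m) N f
sumRange-cons {m} {suc N} f (s≤s 1+m≤N) with ℕ.m≤n⇒m<n∨m≡n 1+m≤N
... | inj₂ refl = begin
  sumRange m (suc (suc m)) f
    ≡⟨ sumRange-snoc f (ℕ.n<1+n m) ⟩
  sumRange m (suc m) f + f (suc m)
    ≡⟨ cong (_+ f (suc m)) (sumRange-empty f (ℕ.≤-refl {suc m})) ⟩
  0ℚ + f (suc m)
    ≡⟨ ℚ.+-comm 0ℚ (f (suc m)) ⟩
  f (suc m) + 0ℚ
    ≡⟨ cong (f (suc m) +_) (sumRange-empty f (ℕ.≤-refl {suc (suc m)})) ⟨
  f (suc m) + sumRange (suc m) (suc (suc m)) f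
    ∎
... | inj₁ 1+m<N = begin
  sumRange m (suc N) f                      ≡⟨ sumRange-snoc f (ℕ.<-trans (ℕ.n<1+n m) 1+m<N) ⟩
  sumRange m N f + f N                      ≡⟨ cong (_+ f N) (sumRange-cons f 1+m<N) ⟩
  (f (suc m) + sumRange (suc m) N f) + f N  ≡⟨ ℚ.+-assoc (f (suc m)) _ (f N) ⟩
  f (suc m) + (sumRange (suc m) N f + f N)  ≡⟨ cong (f (suc m) +_) (sumRange-snoc f 1+m<N) ⟨
  f (suc m) + sumRange (suc m) (suc N) f    ∎

sumRange-cong : ∀ m N {f g : ℕ → ℚ} → (∀ {n} → m < n → n < N → f n ≡ g n) →
                sumRange m N f ≡ sumRange m N g
sumRange-cong m N {f} {g} = downward-induction N P base step m
  where
  P : ℕ → Set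
  P m = (∀ {n} → m < n → n < N → f n ≡ g n) → sumRange m N f ≡ sumRange m N g
  base : ∀ m → N ≤ suc m → P m
  base m N≤1+m _ = trans (sumRange-empty f N≤1+m) (sym (sumRange-empty g N≤1+m))
  step : ∀ m → suc m < N → P (suc m) → P m
  step m 1+m<N ih f≗g = begin
    sumRange m N f                    ≡⟨ sumRange-cons f 1+m<N ⟩
    f (suc m) + sumRange (suc m) N f  ≡⟨ cong₂ _+_ (f≗g (ℕ.n<1+n m) 1+m<N)
                                                   (ih (f≗g ∘ ℕ.<-trans (ℕ.n<1+n m))) ⟩
    g (suc m) + sumRange (suc m) N g  ≡⟨ sumRange-cons g 1+m<N ⟨
    sumRange m N g                    ∎

sumRange-*ˡ : ∀ m N α (f : ℕ → ℚ) → sumRange m N (λ n → α * f n) ≡ α * sumRange m N f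
sumRange-*ˡ m N α f = downward-induction N P base step m
  where
  P : ℕ → Set
  P m = sumRange m N (λ n → α * f n) ≡ α * sumRange m N f
  base : ∀ m → N ≤ suc m → P m
  base m N≤1+m = begin
    sumRange m N (λ n → α * f n)  ≡⟨ sumRange-empty _ N≤1+m ⟩
    0ℚ                            ≡⟨ ℚ.*-zeroʳ α ⟨
    α * 0ℚ                        ≡⟨ cong (α *_) (sumRange-empty f N≤1+m) ⟨
    α * sumRange m N f            ∎
  step : ∀ m → suc m < N → P (suc m) → P m
  step m 1+m<N ih = begin
    sumRange m N (λ n → α * f n)                        ≡⟨ sumRange-cons _ 1+m<N ⟩
    α * f (suc m) + sumRange (suc m) N (λ n → α * f n)  ≡⟨ cong (α * f (suc m) +_) ih ⟩
    α * f (suc m) + α * sumRange (suc m) N f            ≡⟨ ℚ.*-distribˡ-+ α _ _ ⟨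
    α * (f (suc m) + sumRange (suc m) N f)              ≡⟨ cong (α *_) (sumRange-cons f 1+m<N) ⟨
    α * sumRange m N f                                  ∎

sumRange-sub : ∀ m N (f g : ℕ → ℚ) →
               sumRange m N (λ n → f n - g n) ≡ sumRange m N f - sumRange m N g
sumRange-sub m N f g = downward-induction N P base step m
  where
  P : ℕ → Set
  P m = sumRange m N (λ n → f n - g n) ≡ sumRange m N f - sumRange m N g
  base : ∀ m → N ≤ suc m → P m
  base m N≤1+m = trans (sumRange-empty _ N≤1+m)
    (sym (cong₂ _-_ (sumRange-empty f N≤1+m) (sumRange-empty g N≤1+m)))
  step : ∀ m → suc m < N → P (suc m) → P m
  step m 1+m<N ih = begin
    sumRange m N (λ n → f n - g n)
      ≡⟨ sumRange-cons _ 1+m<N ⟩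
    (f (suc m) - g (suc m)) + sumRange (suc m) N (λ n → f n - g n)
      ≡⟨ cong (f (suc m) - g (suc m) +_) ih ⟩
    (f (suc m) - g (suc m)) + (sumRange (suc m) N f - sumRange (suc m) N g)
      ≡⟨ solve 4 (λ a b A B → (a :- b) :+ (A :- B) := (a :+ A) :- (b :+ B)) refl
                 (f (suc m)) (g (suc m)) (sumRange (suc m) N f) (sumRange (suc m) N g) ⟩
    (f (suc m) + sumRange (suc m) N f) - (g (suc m) + sumRange (suc m) N g)
      ≡⟨ cong₂ _-_ (sumRange-cons f 1+m<N) (sumRange-cons g 1+m<N) ⟨
    sumRange m N f - sumRange m N g
      ∎

sumRange-telescope : ∀ m N (C : ℕ → ℚ) → m < N →
                     sumRange m N (λ n → C (suc n) - C n) ≡ C N - C (suc m)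
sumRange-telescope m N C = downward-induction N P base step m
  where
  P : ℕ → Set
  P m = m < N → sumRange m N (λ n → C (suc n) - C n) ≡ C N - C (suc m)
  base : ∀ m → N ≤ suc m → P m
  base m N≤1+m m<N = begin
    sumRange m N (λ n → C (suc n) - C n)  ≡⟨ sumRange-empty _ N≤1+m ⟩
    0ℚ                                   ≡⟨ ℚ.+-inverseʳ (C N) ⟨
    C N - C N                            ≡⟨ cong (λ k → C N - C k) (ℕ.≤-antisym N≤1+m m<N) ⟩
    C N - C (suc m)                      ∎
  step : ∀ m → suc m < N → P (suc m) → P m
  step m 1+m<N ih _ = begin
    sumRange m N (λ n → C (suc n) - C n)
      ≡⟨ sumRange-cons _ 1+m<N ⟩
    (C (suc (suc m)) - C (suc m)) + sumRange (suc m) N (λ n → C (suc n) - C n)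
      ≡⟨ cong (C (suc (suc m)) - C (suc m) +_) (ih 1+m<N) ⟩
    (C (suc (suc m)) - C (suc m)) + (C N - C (suc (suc m)))
      ≡⟨ solve 3 (λ c₂ c₁ c → (c₂ :- c₁) :+ (c :- c₂) := c :- c₁) refl
                 (C (suc (suc m))) (C (suc m)) (C N) ⟩
    C N - C (suc m)
      ∎

sumRange-by-parts : ∀ m N (C w : ℕ → ℚ) →
  sumRange m N (λ n → (C (suc n) - C n) * sumRange n N w)
    ≡ sumRange m N (λ n → w n * C n) - C (suc m) * sumRange m N w
sumRange-by-parts m N C w = downward-induction N P base step m
  where
  P : ℕ → Set
  P m = sumRange m N (λ n → (C (suc n) - C n) * sumRange n N w)
          ≡ sumRange m N (λ n → w n * C n) - C (suc m) * sumRange m N w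
  base : ∀ m → N ≤ suc m → P m
  base m N≤1+m = begin
    sumRange m N (λ n → (C (suc n) - C n) * sumRange n N w)
      ≡⟨ sumRange-empty _ N≤1+m ⟩
    0ℚ
      ≡⟨ solve 1 (λ c → con 0ℚ := con 0ℚ :- c :* con 0ℚ) refl (C (suc m)) ⟩
    0ℚ - C (suc m) * 0ℚ
      ≡⟨ cong₂ (λ s t → s - C (suc m) * t) (sumRange-empty _ N≤1+m) (sumRange-empty w N≤1+m) ⟨
    sumRange m N (λ n → w n * C n) - C (suc m) * sumRange m N w
      ∎
  step : ∀ m → suc m < N → P (suc m) → P m
  step m 1+m<N ih = begin
    sumRange m N (λ n → (C (suc n) - C n) * sumRange n N w)
      ≡⟨ sumRange-cons _ 1+m<N ⟩
    (C₂ - C₁) * T + sumRange (suc m) N (λ n → (C (suc n) - C n) * sumRange n N w)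
      ≡⟨ cong ((C₂ - C₁) * T +_) ih ⟩
    (C₂ - C₁) * T + (S - C₂ * T)
      ≡⟨ solve 5 (λ C₂ C₁ T S w₁ → (C₂ :- C₁) :* T :+ (S :- C₂ :* T)
                                     := (w₁ :* C₁ :+ S) :- C₁ :* (w₁ :+ T))
                 refl C₂ C₁ T S (w (suc m)) ⟩
    (w (suc m) * C₁ + S) - C₁ * (w (suc m) + T)
      ≡⟨ cong₂ (λ s t → s - C₁ * t) (sumRange-cons _ 1+m<N) (sumRange-cons w 1+m<N) ⟨
    sumRange m N (λ n → w n * C n) - C₁ * sumRange m N w
      ∎
    where
    C₁ C₂ T S : ℚ
    C₁ = C (suc m)
    C₂ = C (suc (suc m))
    T = sumRange (suc m) N w
    S = sumRange (suc m) N (λ n → w n * C n)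

falling-suc : ∀ a n → fallingℚ a (suc n) ≡ a * fallingℚ (a - 1ℚ) n
falling-suc a zero = solve 1 (λ a → con 1ℚ :* (a :- con 0ℚ) := a :* con 1ℚ) refl a
falling-suc a (suc n) = begin
  fallingℚ a (suc n) * (a - ℕ→ℚ (suc n))
    ≡⟨ cong₂ (λ F k → F * (a - k)) (falling-suc a n) (ℕ→ℚ-suc n) ⟩
  (a * fallingℚ (a - 1ℚ) n) * (a - (1ℚ + ℕ→ℚ n))
    ≡⟨ solve 3 (λ a F k → (a :* F) :* (a :- (con 1ℚ :+ k)) := a :* (F :* ((a :- con 1ℚ) :- k)))
               refl a (fallingℚ (a - 1ℚ) n) (ℕ→ℚ n) ⟩
  a * (fallingℚ (a - 1ℚ) n * ((a - 1ℚ) - ℕ→ℚ n))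
    ∎

falling-≢0 : ∀ a n → (∀ {j} → j < n → a ≢ ℕ→ℚ j) → fallingℚ a n ≢ 0ℚ
falling-≢0 a zero    _     = ℚ.1≢0
falling-≢0 a (suc n) a≢j<n =
  *-≢0 (falling-≢0 a n (a≢j<n ∘ ℕ.m<n⇒m<1+n)) (-≢0 (a≢j<n (ℕ.n<1+n n)))

falling[n,1+n]≡0 : ∀ n → fallingℚ (ℕ→ℚ n) (suc n) ≡ 0ℚ
falling[n,1+n]≡0 n = begin
  F * (ℕ→ℚ n - ℕ→ℚ n)  ≡⟨ cong (F *_) (ℚ.+-inverseʳ (ℕ→ℚ n)) ⟩
  F * 0ℚ              ≡⟨ ℚ.*-zeroʳ F ⟩
  0ℚ                  ∎
  where
  F : ℚ
  F = fallingℚ (ℕ→ℚ n) n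

binom÷binom≡falling÷falling : ∀ c d n → binomℚ c n ÷ binomℚ d n ≡ fallingℚ c n ÷ fallingℚ d n
binom÷binom≡falling÷falling c d n = begin
  (Fc * inv n!) * inv (Fd * inv n!)        ≡⟨ cong ((Fc * inv n!) *_) (inv-* Fd (inv n!)) ⟩
  (Fc * inv n!) * (inv Fd * inv (inv n!))  ≡⟨ cong (λ m → (Fc * inv n!) * (inv Fd * m)) (inv-involutive n!) ⟩
  (Fc * inv n!) * (inv Fd * n!)            ≡⟨ solve 4 (λ a i b m → (a :* i) :* (b :* m) := (a :* b) :* (m :* i))
                                                      refl Fc (inv n!) (inv Fd) n! ⟩
  (Fc * inv Fd) * (n! * inv n!)            ≡⟨ cong ((Fc * inv Fd) *_)
                                                     (*-inv (ℕ→ℚ-≢0 (n ℕ.!) {{n ℕ.!≢0}})) ⟩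
  (Fc * inv Fd) * 1ℚ                       ≡⟨ ℚ.*-identityʳ _ ⟩
  Fc * inv Fd                              ∎
  where
  Fc Fd n! : ℚ
  Fc = fallingℚ c n
  Fd = fallingℚ d n
  n! = ℕ→ℚ (n ℕ.!)

falling-ratio-suc : ∀ c d n → fallingℚ c (suc n) ÷ fallingℚ d (suc n)
                              ≡ (fallingℚ c n ÷ fallingℚ d n) * ((c - ℕ→ℚ n) ÷ (d - ℕ→ℚ n))
falling-ratio-suc c d n = begin
  (Fc * (c - ℕ→ℚ n)) * inv (Fd * (d - ℕ→ℚ n))
    ≡⟨ cong ((Fc * (c - ℕ→ℚ n)) *_) (inv-* Fd (d - ℕ→ℚ n)) ⟩
  (Fc * (c - ℕ→ℚ n)) * (inv Fd * inv (d - ℕ→ℚ n))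
    ≡⟨ solve 4 (λ a b i j → (a :* b) :* (i :* j) := (a :* i) :* (b :* j))
               refl Fc (c - ℕ→ℚ n) (inv Fd) (inv (d - ℕ→ℚ n)) ⟩
  (Fc * inv Fd) * ((c - ℕ→ℚ n) * inv (d - ℕ→ℚ n))
    ∎
  where
  Fc Fd : ℚ
  Fc = fallingℚ c n
  Fd = fallingℚ d n

falling-ratio-pred : ∀ c a n → a ≢ ℕ→ℚ n →
  fallingℚ c n ÷ fallingℚ a n ≡ ((a - ℕ→ℚ n) ÷ a) * (fallingℚ c n ÷ fallingℚ (a - 1ℚ) n)
falling-ratio-pred c a n a≢n = begin
  Fc * inv Fa                   ≡⟨ ℚ.*-identityʳ _ ⟨
  (Fc * inv Fa) * 1ℚ            ≡⟨ cong ((Fc * inv Fa) *_) (*-inv (-≢0 a≢n)) ⟨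
  (Fc * inv Fa) * (d * inv d)   ≡⟨ solve 4 (λ F i d j → (F :* i) :* (d :* j) := d :* F :* (i :* j))
                                           refl Fc (inv Fa) d (inv d) ⟩
  d * Fc * (inv Fa * inv d)     ≡⟨ cong (d * Fc *_) (inv-* Fa d) ⟨
  d * Fc * inv (Fa * d)         ≡⟨ cong (λ F → d * Fc * inv F) (falling-suc a n) ⟩
  d * Fc * inv (a * Fa′)        ≡⟨ cong (d * Fc *_) (inv-* a Fa′) ⟩
  d * Fc * (inv a * inv Fa′)    ≡⟨ solve 4 (λ d F i j → d :* F :* (i :* j) := (d :* i) :* (F :* j))
                                           refl d Fc (inv a) (inv Fa′) ⟩
  (d * inv a) * (Fc * inv Fa′)  ∎
  where
  Fc Fa Fa′ d : ℚ
  Fc = fallingℚ c n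
  Fa = fallingℚ a n
  Fa′ = fallingℚ (a - 1ℚ) n
  d = a - ℕ→ℚ n

antidifference : ℚ → ℚ → ℕ → ℚ
antidifference c a n = (a ÷ (a - c)) * (1ℚ - fallingℚ c n ÷ fallingℚ a n)

antidifference-step : ∀ {c a} n → a ≢ 0ℚ → a ≢ c → a ≢ ℕ→ℚ n →
  antidifference c a (suc n) - antidifference c a n ≡ fallingℚ c n ÷ fallingℚ (a - 1ℚ) n
antidifference-step {c} {a} n a≢0 a≢c a≢n = begin
  α * (1ℚ - fallingℚ c (suc n) ÷ fallingℚ a (suc n)) - α * (1ℚ - fallingℚ c n ÷ fallingℚ a n)
    ≡⟨ cong₂ (λ r′ r → α * (1ℚ - r′) - α * (1ℚ - r))
             (trans (falling-ratio-suc c a n) (cong (_* ((c - k) ÷ (a - k))) (falling-ratio-pred c a n a≢n)))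
             (falling-ratio-pred c a n a≢n) ⟩
  α * (1ℚ - (((a - k) * inv a) * ρ) * ((c - k) * inv (a - k))) - α * (1ℚ - ((a - k) * inv a) * ρ)
    ≡⟨ solve 7 (λ a c k ρ ia ib iac →
                  (a :* iac) :* (con 1ℚ :- (((a :- k) :* ia) :* ρ) :* ((c :- k) :* ib))
                    :- (a :* iac) :* (con 1ℚ :- ((a :- k) :* ia) :* ρ)
                  := ρ :* ((a :* ia) :* (iac :* ((a :- k) :- (c :- k) :* ((a :- k) :* ib)))))
               refl a c k ρ (inv a) (inv (a - k)) (inv (a - c)) ⟩
  ρ * ((a * inv a) * (inv (a - c) * ((a - k) - (c - k) * ((a - k) * inv (a - k)))))
    ≡⟨ cong₂ (λ u v → ρ * (u * (inv (a - c) * ((a - k) - (c - k) * v))))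
             (*-inv a≢0) (*-inv (-≢0 a≢n)) ⟩
  ρ * (1ℚ * (inv (a - c) * ((a - k) - (c - k) * 1ℚ)))
    ≡⟨ solve 5 (λ a c k ρ iac → ρ :* (con 1ℚ :* (iac :* ((a :- k) :- (c :- k) :* con 1ℚ)))
                                  := ρ :* ((a :- c) :* iac))
               refl a c k ρ (inv (a - c)) ⟩
  ρ * ((a - c) * inv (a - c))
    ≡⟨ cong (ρ *_) (*-inv (-≢0 a≢c)) ⟩
  ρ * 1ℚ
    ≡⟨ ℚ.*-identityʳ ρ ⟩
  ρ ∎
  where
  α k ρ : ℚ
  α = a ÷ (a - c)
  k = ℕ→ℚ n
  ρ = fallingℚ c n ÷ fallingℚ (a - 1ℚ) n

antidifference-one : ∀ {c a} → a ≢ 0ℚ → a ≢ c → antidifference c a 1 ≡ 1ℚ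
antidifference-one {c} {a} a≢0 a≢c = begin
  antidifference c a 1                         ≡⟨ ℚ.+-identityʳ _ ⟨
  antidifference c a 1 - 0ℚ                    ≡⟨ cong (λ t → antidifference c a 1 - t)
                                                       (ℚ.*-zeroʳ (a ÷ (a - c))) ⟨
  antidifference c a 1 - antidifference c a 0  ≡⟨ antidifference-step 0 a≢0 a≢c a≢0 ⟩
  1ℚ                                           ∎

Generic₁ : ℕ → ℚ → Set
Generic₁ N x = (j : ℕ) → j ≤ N → ℕ→ℚ N * x ≢ ℕ→ℚ j

module _ (N-1 : ℕ) where

  private
    N : ℕ
    N = suc N-1

  weight : ℕ → ℚ → ℚ → ℕ → ℚ
  weight k y x n = inv (ℕ→ℚ n ^ k) * binomRatio N y x n

  scale : ℚ → ℚ → ℚ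
  scale x y = ℕ→ℚ N * x ÷ (ℕ→ℚ N * x - (ℕ→ℚ N * y - 1ℚ))

  N*invN : ℕ→ℚ N * invN N ≡ 1ℚ
  N*invN = *-inv (ℕ→ℚ-≢0 N)

  N[x+invN]-1 : ∀ x → ℕ→ℚ N * (x + invN N) - 1ℚ ≡ ℕ→ℚ N * x
  N[x+invN]-1 x = begin
    ℕ→ℚ N * (x + invN N) - 1ℚ          ≡⟨ solve 3 (λ n x i → n :* (x :+ i) :- con 1ℚ
                                                          := n :* x :+ (n :* i :- con 1ℚ))
                                                  refl (ℕ→ℚ N) x (invN N) ⟩
    ℕ→ℚ N * x + (ℕ→ℚ N * invN N - 1ℚ)  ≡⟨ cong (λ t → ℕ→ℚ N * x + (t - 1ℚ)) N*invN ⟩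
    ℕ→ℚ N * x + 0ℚ                     ≡⟨ ℚ.+-identityʳ _ ⟩
    ℕ→ℚ N * x                          ∎

  N*x-[N*y-1] : ∀ x y → ℕ→ℚ N * x - (ℕ→ℚ N * y - 1ℚ) ≡ ℕ→ℚ N * (x + invN N - y)
  N*x-[N*y-1] x y = begin
    ℕ→ℚ N * x - (ℕ→ℚ N * y - 1ℚ)
      ≡⟨ solve 4 (λ n x y i → n :* x :- (n :* y :- con 1ℚ) := n :* (x :+ i :- y) :+ (con 1ℚ :- n :* i))
                 refl (ℕ→ℚ N) x y (invN N) ⟩
    ℕ→ℚ N * (x + invN N - y) + (1ℚ - ℕ→ℚ N * invN N)
      ≡⟨ cong (λ t → ℕ→ℚ N * (x + invN N - y) + (1ℚ - t)) N*invN ⟩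
    ℕ→ℚ N * (x + invN N - y) + 0ℚ
      ≡⟨ ℚ.+-identityʳ _ ⟩
    ℕ→ℚ N * (x + invN N - y)
      ∎

  inv-N*x : ∀ x → ℕ→ℚ N * inv (ℕ→ℚ N * x) ≡ inv x
  inv-N*x x = begin
    ℕ→ℚ N * inv (ℕ→ℚ N * x)   ≡⟨ cong (ℕ→ℚ N *_) (inv-* (ℕ→ℚ N) x) ⟩
    ℕ→ℚ N * (invN N * inv x)  ≡⟨ ℚ.*-assoc (ℕ→ℚ N) (invN N) (inv x) ⟨
    (ℕ→ℚ N * invN N) * inv x  ≡⟨ cong (_* inv x) N*invN ⟩
    1ℚ * inv x                ≡⟨ ℚ.*-identityˡ (inv x) ⟩
    inv x                     ∎

  inv-x*scale : ∀ x y → x ≢ 0ℚ → inv x * scale x y ≡ inv (x + invN N - y)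
  inv-x*scale x y x≢0 = begin
    inv x * (ℕ→ℚ N * x * inv (ℕ→ℚ N * x - (ℕ→ℚ N * y - 1ℚ)))
      ≡⟨ cong (λ t → inv x * (ℕ→ℚ N * x * inv t)) (N*x-[N*y-1] x y) ⟩
    inv x * (ℕ→ℚ N * x * inv (ℕ→ℚ N * d))
      ≡⟨ cong (λ t → inv x * (ℕ→ℚ N * x * t)) (inv-* (ℕ→ℚ N) d) ⟩
    inv x * (ℕ→ℚ N * x * (invN N * inv d))
      ≡⟨ solve 5 (λ i n x j e → i :* (n :* x :* (j :* e)) := (x :* i) :* (n :* j) :* e)
                 refl (inv x) (ℕ→ℚ N) x (invN N) (inv d) ⟩
    (x * inv x) * (ℕ→ℚ N * invN N) * inv d
      ≡⟨ cong₂ (λ u v → u * v * inv d) (*-inv x≢0) N*invN ⟩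
    1ℚ * 1ℚ * inv d
      ≡⟨ ℚ.*-identityˡ (inv d) ⟩
    inv d
      ∎
    where
    d : ℚ
    d = x + invN N - y

  generic⇒≢0 : ∀ x → Generic₁ N x → x ≢ 0ℚ
  generic⇒≢0 _ gx refl = gx 0 z≤n (ℚ.*-zeroʳ (ℕ→ℚ N))

  N*x≢N*y-1 : ∀ x y → x + invN N ≢ y → ℕ→ℚ N * x ≢ ℕ→ℚ N * y - 1ℚ
  N*x≢N*y-1 x y x+invN≢y a≡c = *-≢0 (ℕ→ℚ-≢0 N) (-≢0 x+invN≢y) (begin
    ℕ→ℚ N * (x + invN N - y)             ≡⟨ N*x-[N*y-1] x y ⟨
    ℕ→ℚ N * x - (ℕ→ℚ N * y - 1ℚ)         ≡⟨ cong (_- (ℕ→ℚ N * y - 1ℚ)) a≡c ⟩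
    (ℕ→ℚ N * y - 1ℚ) - (ℕ→ℚ N * y - 1ℚ)  ≡⟨ ℚ.+-inverseʳ (ℕ→ℚ N * y - 1ℚ) ⟩
    0ℚ                                   ∎)

  binomRatio-shift-falling : ∀ y x n →
    binomRatio N y (x + invN N) n ≡ fallingℚ (ℕ→ℚ N * y - 1ℚ) n ÷ fallingℚ (ℕ→ℚ N * x) n
  binomRatio-shift-falling y x n = trans (binom÷binom≡falling÷falling _ _ n)
    (cong (λ d → fallingℚ (ℕ→ℚ N * y - 1ℚ) n ÷ fallingℚ d n) (N[x+invN]-1 x))

  binomRatio-shift : ∀ y x n → ℕ→ℚ N * x ≢ ℕ→ℚ n →
    binomRatio N y (x + invN N) n ≡ ((ℕ→ℚ N * x - ℕ→ℚ n) ÷ (ℕ→ℚ N * x)) * binomRatio N y x n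
  binomRatio-shift y x n a≢n = begin
    binomRatio N y (x + invN N) n
      ≡⟨ binomRatio-shift-falling y x n ⟩
    fallingℚ c n ÷ fallingℚ a n
      ≡⟨ falling-ratio-pred c a n a≢n ⟩
    ((a - ℕ→ℚ n) ÷ a) * (fallingℚ c n ÷ fallingℚ (a - 1ℚ) n)
      ≡⟨ cong (((a - ℕ→ℚ n) ÷ a) *_) (binom÷binom≡falling÷falling c (a - 1ℚ) n) ⟨
    ((a - ℕ→ℚ n) ÷ a) * binomRatio N y x n
      ∎
    where
    a c : ℚ
    a = ℕ→ℚ N * x
    c = ℕ→ℚ N * y - 1ℚ

  Δ-weight : ∀ k y x {n} → Generic₁ N x → 0 < n → n ≤ N →
    ℕ→ℚ N * (weight (suc k) y (x + invN N) n - weight (suc k) y x n) ≡ - inv x * weight k y x n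
  Δ-weight k y x {suc m} gx _ n≤N = begin
    ℕ→ℚ N * (inv (n * n ^ k) * ρ′ - inv (n * n ^ k) * ρ)
      ≡⟨ cong₂ (λ I r → ℕ→ℚ N * (I * r - I * ρ))
               (inv-* n (n ^ k)) (binomRatio-shift y x (suc m) (gx (suc m) n≤N)) ⟩
    ℕ→ℚ N * ((inv n * K) * (((a - n) * inv a) * ρ) - (inv n * K) * ρ)
      ≡⟨ solve 7 (λ N n i K a ia ρ → N :* ((i :* K) :* (((a :- n) :* ia) :* ρ) :- (i :* K) :* ρ)
                                       := N :* K :* ρ :* (i :* (a :* ia) :- (n :* i) :* ia :- i))
                 refl (ℕ→ℚ N) n (inv n) K a (inv a) ρ ⟩
    ℕ→ℚ N * K * ρ * (inv n * (a * inv a) - (n * inv n) * inv a - inv n)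
      ≡⟨ cong₂ (λ u v → ℕ→ℚ N * K * ρ * (inv n * u - v * inv a - inv n))
               (*-inv (gx 0 z≤n)) (*-inv (ℕ→ℚ-≢0 (suc m))) ⟩
    ℕ→ℚ N * K * ρ * (inv n * 1ℚ - 1ℚ * inv a - inv n)
      ≡⟨ solve 5 (λ N K ρ i ia → N :* K :* ρ :* (i :* con 1ℚ :- con 1ℚ :* ia :- i)
                                   := :- (N :* ia) :* (K :* ρ))
                 refl (ℕ→ℚ N) K ρ (inv n) (inv a) ⟩
    - (ℕ→ℚ N * inv a) * (K * ρ)
      ≡⟨ cong (λ t → - t * (K * ρ)) (inv-N*x x) ⟩
    - inv x * (K * ρ)
      ∎
    where
    n a K ρ ρ′ : ℚ
    n = ℕ→ℚ (suc m)
    a = ℕ→ℚ N * x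
    K = inv (n ^ k)
    ρ = binomRatio N y x (suc m)
    ρ′ = binomRatio N y (x + invN N) (suc m)

  Δ₁-Li-suc : ∀ {r} k (ks : Vec ℕ r) x xs → Generic₁ N x →
    Δ₁ N (Li N (suc k ∷ ks)) (x ∷ xs) ≡ - inv x * Li N (k ∷ ks) (x ∷ xs)
  Δ₁-Li-suc k ks x xs gx = begin
    ℕ→ℚ N * (sumRange 0 N (λ n → w′ n * L n) - sumRange 0 N (λ n → w n * L n))
      ≡⟨ cong (ℕ→ℚ N *_) (sumRange-sub 0 N (λ n → w′ n * L n) (λ n → w n * L n)) ⟨
    ℕ→ℚ N * sumRange 0 N (λ n → w′ n * L n - w n * L n)
      ≡⟨ sumRange-*ˡ 0 N (ℕ→ℚ N) (λ n → w′ n * L n - w n * L n) ⟨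
    sumRange 0 N (λ n → ℕ→ℚ N * (w′ n * L n - w n * L n))
      ≡⟨ sumRange-cong 0 N termwise ⟩
    sumRange 0 N (λ n → - inv x * (weight k y x n * L n))
      ≡⟨ sumRange-*ˡ 0 N (- inv x) (λ n → weight k y x n * L n) ⟩
    - inv x * sumRange 0 N (λ n → weight k y x n * L n)
      ∎
    where
    y : ℚ
    y = nextX xs
    w′ w L : ℕ → ℚ
    w′ = weight (suc k) y (x + invN N)
    w = weight (suc k) y x
    L n = LiFrom N n ks xs
    termwise : ∀ {n} → 0 < n → n < N →
               ℕ→ℚ N * (w′ n * L n - w n * L n) ≡ - inv x * (weight k y x n * L n)
    termwise {n} 0<n n<N = begin
      ℕ→ℚ N * (w′ n * L n - w n * L n)  ≡⟨ solve 4 (λ N u v l → N :* (u :* l :- v :* l)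
                                                                := (N :* (u :- v)) :* l)
                                                   refl (ℕ→ℚ N) (w′ n) (w n) (L n) ⟩
      ℕ→ℚ N * (w′ n - w n) * L n        ≡⟨ cong (_* L n) (Δ-weight k y x gx 0<n (ℕ.<⇒≤ n<N)) ⟩
      - inv x * weight k y x n * L n    ≡⟨ ℚ.*-assoc (- inv x) (weight k y x n) (L n) ⟩
      - inv x * (weight k y x n * L n)  ∎

  weight-zero-telescopes : ∀ y x {n} → Generic₁ N x → ℕ→ℚ N * x ≢ ℕ→ℚ N * y - 1ℚ → n < N →
    weight 0 y x n ≡ antidifference (ℕ→ℚ N * y - 1ℚ) (ℕ→ℚ N * x) (suc n)
                       - antidifference (ℕ→ℚ N * y - 1ℚ) (ℕ→ℚ N * x) n
  weight-zero-telescopes y x {n} gx a≢c n<N = begin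
    1ℚ * binomRatio N y x n
      ≡⟨ ℚ.*-identityˡ _ ⟩
    binomRatio N y x n
      ≡⟨ binom÷binom≡falling÷falling c (a - 1ℚ) n ⟩
    fallingℚ c n ÷ fallingℚ (a - 1ℚ) n
      ≡⟨ antidifference-step n (gx 0 z≤n) a≢c (gx n (ℕ.<⇒≤ n<N)) ⟨
    antidifference c a (suc n) - antidifference c a n
      ∎
    where
    a c : ℚ
    a = ℕ→ℚ N * x
    c = ℕ→ℚ N * y - 1ℚ

  weight-antidifference : ∀ k z y x {m} (L : ℚ) → Generic₁ N y → m ≤ N →
    (weight k z y m * L) * antidifference (ℕ→ℚ N * y - 1ℚ) (ℕ→ℚ N * x) m
      ≡ scale x y * (weight k z y m * L - weight k z (x + invN N) m * L)
  weight-antidifference k z y x {m} L gy m≤N = begin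
    (K * ρ * L) * (α * (1ℚ - r))
      ≡⟨ solve 5 (λ K ρ L α r → (K :* ρ :* L) :* (α :* (con 1ℚ :- r))
                                  := α :* (K :* ρ :* L :- K :* (ρ :* r) :* L))
                 refl K ρ L α r ⟩
    α * (K * ρ * L - K * (ρ * r) * L)
      ≡⟨ cong (λ t → α * (K * ρ * L - K * t * L)) ρ*r ⟩
    α * (K * ρ * L - K * binomRatio N z (x + invN N) m * L)
      ∎
    where
    c e K ρ α r : ℚ
    c = ℕ→ℚ N * y - 1ℚ
    e = ℕ→ℚ N * z - 1ℚ
    K = inv (ℕ→ℚ m ^ k)
    ρ = binomRatio N z y m
    α = scale x y
    r = fallingℚ c m ÷ fallingℚ (ℕ→ℚ N * x) m
    c≢j<m : ∀ {j} → j < m → c ≢ ℕ→ℚ j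
    c≢j<m {j} j<m = pred-≢ j (gy (suc j) (ℕ.≤-trans j<m m≤N))
    ρ*r : ρ * r ≡ binomRatio N z (x + invN N) m
    ρ*r = begin
      ρ * r                                        ≡⟨ cong (_* r) (binom÷binom≡falling÷falling e c m) ⟩
      (fallingℚ e m ÷ fallingℚ c m) * r            ≡⟨ ÷-*-÷ (fallingℚ e m) (fallingℚ (ℕ→ℚ N * x) m)
                                                           (falling-≢0 c m c≢j<m) ⟩
      fallingℚ e m ÷ fallingℚ (ℕ→ℚ N * x) m        ≡⟨ binomRatio-shift-falling z x m ⟨
      binomRatio N z (x + invN N) m                ∎

  weight-zero-sum-by-parts : ∀ {r} k (ks : Vec ℕ r) x y xs → Generic₁ N x → Generic₁ N y →
    ℕ→ℚ N * x ≢ ℕ→ℚ N * y - 1ℚ →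
    sumRange 0 N (λ n → weight 0 y x n * LiFrom N n (k ∷ ks) (y ∷ xs))
      ≡ scale x y * (Li N (k ∷ ks) (y ∷ xs) - Li N (k ∷ ks) ((x + invN N) ∷ xs)) - Li N (k ∷ ks) (y ∷ xs)
  weight-zero-sum-by-parts k ks x y xs gx gy a≢c = begin
    sumRange 0 N (λ n → weight 0 y x n * sumRange n N w)
      ≡⟨ sumRange-cong 0 N (λ {n} _ n<N →
           cong (_* sumRange n N w) (weight-zero-telescopes y x gx a≢c n<N)) ⟩
    sumRange 0 N (λ n → (C (suc n) - C n) * sumRange n N w)
      ≡⟨ sumRange-by-parts 0 N C w ⟩
    sumRange 0 N (λ n → w n * C n) - C 1 * W
      ≡⟨ cong₂ (λ s t → s - t * W) weighted (antidifference-one (gx 0 z≤n) a≢c) ⟩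
    α * (W - Wa) - 1ℚ * W
      ≡⟨ cong (λ t → α * (W - Wa) - t) (ℚ.*-identityˡ W) ⟩
    α * (W - Wa) - W
      ∎
    where
    z α W Wa : ℚ
    z = nextX xs
    α = scale x y
    C w wa L : ℕ → ℚ
    C = antidifference (ℕ→ℚ N * y - 1ℚ) (ℕ→ℚ N * x)
    L m = LiFrom N m ks xs
    w m = weight k z y m * L m
    wa m = weight k z (x + invN N) m * L m
    W = sumRange 0 N w
    Wa = sumRange 0 N wa
    weighted : sumRange 0 N (λ m → w m * C m) ≡ α * (W - Wa)
    weighted = begin
      sumRange 0 N (λ m → w m * C m)
        ≡⟨ sumRange-cong 0 N (λ {m} _ m<N → weight-antidifference k z y x (L m) gy (ℕ.<⇒≤ m<N)) ⟩
      sumRange 0 N (λ m → α * (w m - wa m))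
        ≡⟨ sumRange-*ˡ 0 N α (λ m → w m - wa m) ⟩
      α * sumRange 0 N (λ m → w m - wa m)
        ≡⟨ cong (α *_) (sumRange-sub 0 N w wa) ⟩
      α * (W - Wa)
        ∎

  Δ₁-Li-[1] : ∀ x → Generic₁ N x → Δ₁ N (Li N (1 ∷ [])) (x ∷ []) ≡ inv x - inv (x + invN N - 1ℚ)
  Δ₁-Li-[1] x gx = begin
    Δ₁ N (Li N (1 ∷ [])) (x ∷ [])
      ≡⟨ Δ₁-Li-suc 0 [] x [] gx ⟩
    - inv x * sumRange 0 N (λ n → weight 0 1ℚ x n * 1ℚ)
      ≡⟨ cong (- inv x *_) telescoped ⟩
    - inv x * (α - 1ℚ)
      ≡⟨ solve 2 (λ i α → :- i :* (α :- con 1ℚ) := i :- i :* α) refl (inv x) α ⟩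
    inv x - inv x * α
      ≡⟨ cong (λ t → inv x - t) (inv-x*scale x 1ℚ (generic⇒≢0 x gx)) ⟩
    inv x - inv (x + invN N - 1ℚ)
      ∎
    where
    a c α : ℚ
    a = ℕ→ℚ N * x
    c = ℕ→ℚ N * 1ℚ - 1ℚ
    α = scale x 1ℚ
    C : ℕ → ℚ
    C = antidifference c a
    c≡N-1 : c ≡ ℕ→ℚ N-1
    c≡N-1 = begin
      ℕ→ℚ N * 1ℚ - 1ℚ      ≡⟨ cong (_- 1ℚ) (trans (ℚ.*-identityʳ (ℕ→ℚ N)) (ℕ→ℚ-suc N-1)) ⟩
      (1ℚ + ℕ→ℚ N-1) - 1ℚ  ≡⟨ solve 1 (λ k → (con 1ℚ :+ k) :- con 1ℚ := k) refl (ℕ→ℚ N-1) ⟩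
      ℕ→ℚ N-1              ∎
    a≢c : a ≢ c
    a≢c = subst (a ≢_) (sym c≡N-1) (gx N-1 (ℕ.n≤1+n N-1))
    C-N : C N ≡ α
    C-N = begin
      α * (1ℚ - fallingℚ c N * inv (fallingℚ a N))
        ≡⟨ cong (λ F → α * (1ℚ - F * inv (fallingℚ a N)))
                (trans (cong (λ c → fallingℚ c N) c≡N-1) (falling[n,1+n]≡0 N-1)) ⟩
      α * (1ℚ - 0ℚ * inv (fallingℚ a N))
        ≡⟨ solve 2 (λ α i → α :* (con 1ℚ :- con 0ℚ :* i) := α) refl α (inv (fallingℚ a N)) ⟩
      α ∎
    telescoped : sumRange 0 N (λ n → weight 0 1ℚ x n * 1ℚ) ≡ α - 1ℚ
    telescoped = begin
      sumRange 0 N (λ n → weight 0 1ℚ x n * 1ℚ)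
        ≡⟨ sumRange-cong 0 N (λ _ n<N →
             trans (ℚ.*-identityʳ _) (weight-zero-telescopes 1ℚ x gx a≢c n<N)) ⟩
      sumRange 0 N (λ n → C (suc n) - C n)
        ≡⟨ sumRange-telescope 0 N C (s≤s z≤n) ⟩
      C N - C 1
        ≡⟨ cong₂ _-_ C-N (antidifference-one (gx 0 z≤n) a≢c) ⟩
      α - 1ℚ
        ∎

  Δ₁-Li-1∷ : ∀ {r} k (ks : Vec ℕ r) x y xs → Generic₁ N x → Generic₁ N y → x + invN N ≢ y →
    Δ₁ N (Li N (1 ∷ k ∷ ks)) (x ∷ y ∷ xs)
      ≡ inv x * Li N (k ∷ ks) (y ∷ xs)
        - inv (x + invN N - y) * (Li N (k ∷ ks) (y ∷ xs) - Li N (k ∷ ks) ((x + invN N) ∷ xs))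
  Δ₁-Li-1∷ k ks x y xs gx gy x+invN≢y = begin
    Δ₁ N (Li N (1 ∷ k ∷ ks)) (x ∷ y ∷ xs)
      ≡⟨ Δ₁-Li-suc 0 (k ∷ ks) x (y ∷ xs) gx ⟩
    - inv x * sumRange 0 N (λ n → weight 0 y x n * LiFrom N n (k ∷ ks) (y ∷ xs))
      ≡⟨ cong (- inv x *_) (weight-zero-sum-by-parts k ks x y xs gx gy (N*x≢N*y-1 x y x+invN≢y)) ⟩
    - inv x * (α * (W - Wa) - W)
      ≡⟨ solve 4 (λ i α W Wa → :- i :* (α :* (W :- Wa) :- W) := i :* W :- i :* α :* (W :- Wa))
                 refl (inv x) α W Wa ⟩
    inv x * W - inv x * α * (W - Wa)
      ≡⟨ cong (λ t → inv x * W - t * (W - Wa)) (inv-x*scale x y (generic⇒≢0 x gx)) ⟩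
    inv x * W - inv (x + invN N - y) * (W - Wa)
      ∎
    where
    α W Wa : ℚ
    α = scale x y
    W = Li N (k ∷ ks) (y ∷ xs)
    Wa = Li N (k ∷ ks) ((x + invN N) ∷ xs)

theorem3p1 : (N : ℕ) → 0 < N →
    ((r : ℕ) (k₁ : ℕ) (ks : Vec ℕ r) (x : Vec ℚ (suc r)) →
      IsIndex (k₁ ∷ ks) → Generic N x → 1 < k₁ →
      Δ₁ N (Li N (k₁ ∷ ks)) x ≡ - (inv (head x) * Li N ((k₁ ∸ 1) ∷ ks) x))
  × ((x₁ : ℚ) → Generic N (x₁ ∷ []) →
      Δ₁ N (Li N (1 ∷ [])) (x₁ ∷ []) ≡ inv x₁ - inv (x₁ + invN N - 1ℚ))
  × ((r : ℕ) (k₂ : ℕ) (ks : Vec ℕ r) (x₁ x₂ : ℚ) (xs : Vec ℚ r) →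
      IsIndex (k₂ ∷ ks) → Generic N (x₁ ∷ x₂ ∷ xs) → x₁ + invN N ≢ x₂ →
      Δ₁ N (Li N (1 ∷ k₂ ∷ ks)) (x₁ ∷ x₂ ∷ xs)
        ≡ inv x₁ * Li N (k₂ ∷ ks) (x₂ ∷ xs)
          - inv (x₁ + invN N - x₂)
            * (Li N (k₂ ∷ ks) (x₂ ∷ xs) - Li N (k₂ ∷ ks) ((x₁ + invN N) ∷ xs)))
-- The index hypotheses are not needed: the identities hold for arbitrary exponents.
theorem3p1 (suc N-1) _ =
    (λ { _ (suc k) ks (x ∷ xs) _ (gx ∷ _) _ →
           trans (Δ₁-Li-suc N-1 k ks x xs gx)
                 (sym (ℚ.neg-distribˡ-* (inv x) (Li (suc N-1) (k ∷ ks) (x ∷ xs)))) })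
  , (λ { x (gx ∷ []) → Δ₁-Li-[1] N-1 x gx })
  , (λ { _ k ks x y xs _ (gx ∷ gy ∷ _) x+invN≢y → Δ₁-Li-1∷ N-1 k ks x y xs gx gy x+invN≢y })
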